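{- Let $(\mathbf{A},\mathbf{P},k)$ be a yes-instance of \textsc{$\mathbf{P}$-Matrix Approximation}, where $\mathbf{P}$ is a binary $p\times q$ matrix. Then $\mathbf{A}$ has at most $p+k$ pairwise distinct rows and at most $q+k$ pairwise distinct columns.
   Context: Let $\mathbf{P}=(p_{ij})$ be a binary $p\times q$ matrix. A binary $m\times n$ matrix $\mathbf{B}=(b_{ij})$ is a $\mathbf{P}$-matrix if there exist a partition $\{I_1,\ldots,I_p\}$ of $\{1,\ldots,m\}$ and a partition $\{J_1,\ldots,J_q\}$ of $\{1,\ldots,n\}$ such that $b_{st}=p_{ij}$ for all $i,j$ and all $s\in I_i$, $t\in J_j$. \textsc{$\mathbf{P}$-Matrix Approximation}: input a binary $m\times n$ matrix $\mathbf{A}$, a binary pattern matrix $\mathbf{P}$ and a nonnegative integer $k$; it is a yes-instance if there is an $m\times n$ $\mathbf{P}$-matrix $\mathbf{B}$ differing from $\mathbf{A}$ in at most $k$ entries. -}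

module Defs where

open import Data.Nat using (ℕ; _+_; _≤_)
open import Data.Bool using (Bool; true; false; if_then_else_)
open import Data.Bool.Properties using (_≟_)
open import Data.Fin using (Fin)
open import Data.Product using (Σ; ∃; _×_)
open import Data.Vec.Functional using (Vector)
open import Data.Vec.Functional as VF using ()
open import Relation.Nullary using (¬_; does)
open import Relation.Binary.PropositionalEquality using (_≡_)

BinMatrix : ℕ → ℕ → Set
BinMatrix m n = Fin m → Fin n → Bool

Σ-Fin : (n : ℕ) → (Fin n → ℕ) → ℕ
Σ-Fin n f = VF.foldr _+_ 0 f

dist : {m n : ℕ} → BinMatrix m n → BinMatrix m n → ℕ
dist {m} {n} A B =
  Σ-Fin m (λ s → Σ-Fin n (λ t → if does (A s t ≟ B s t) then 0 else 1))

-- A partition {I_1..I_p} of {1..m} is encoded by the map sending s to the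
-- index i of the block I_i containing s (blocks may be empty).
-- B is a P-matrix
IsPMatrix : {p q m n : ℕ} → BinMatrix p q → BinMatrix m n → Set
IsPMatrix {p} {q} {m} {n} P B =
  Σ (Fin m → Fin p) λ rowPart →
  Σ (Fin n → Fin q) λ colPart →
  ∀ s t → B s t ≡ P (rowPart s) (colPart t)

YesInstance : {p q m n : ℕ} → BinMatrix m n → BinMatrix p q → ℕ → Set
YesInstance {m = m} {n = n} A P k =
  Σ (BinMatrix m n) λ B → IsPMatrix P B × dist A B ≤ k

row : {m n : ℕ} → BinMatrix m n → Fin m → Fin n → Bool
row A s = A s

col : {m n : ℕ} → BinMatrix m n → Fin n → Fin m → Bool
col A t = λ s → A s t

AtMostDistinctRows : {m n : ℕ} → BinMatrix m n → ℕ → Set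
AtMostDistinctRows {m} A c =
  ∀ (r : ℕ) (g : Fin r → Fin m) →
  (∀ i j → ¬ i ≡ j → ∃ λ t → ¬ row A (g i) t ≡ row A (g j) t) → r ≤ c

AtMostDistinctCols : {m n : ℕ} → BinMatrix m n → ℕ → Set
AtMostDistinctCols {n = n} A c =
  ∀ (r : ℕ) (g : Fin r → Fin n) →
  (∀ i j → ¬ i ≡ j → ∃ λ s → ¬ col A (g i) s ≡ col A (g j) s) → r ≤ c

-- A row of A that B leaves untouched equals a row of P, so it is determined
-- by its block index (p choices); every other row contains a changed entry,
-- and distinct such rows contain distinct changed entries (at most dist A B
-- of them). Hence the distinct rows of A inject into Fin p ⊎ Fin (dist A B).
-- Columns follow by transposing.
module Submission where

open import Defs
open import Data.Nat using (ℕ; _+_)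
open import Data.Product using (_×_)

open import Data.Nat using (zero; suc; _≤_; _<_; s≤s; z≤n)
open import Data.Nat.Properties
  using (≤-trans; ≤-reflexive; m≤m+n; m≤n+m; +-monoʳ-≤; +-0-commutativeMonoid)
open import Data.Bool using (if_then_else_)
open import Data.Bool.Properties using (_≟_)
open import Data.Fin using (Fin; zero; suc; fromℕ<; _↑ˡ_; _↑ʳ_; splitAt; join)
open import Data.Fin.Properties using (injective⇒≤; any?; ↑ʳ-injective; splitAt-↑ˡ; splitAt-↑ʳ; splitAt-join)
  renaming (_≟_ to _≟ᶠ_)
open import Data.Product using (∃; _,_)
open import Data.Sum using (_⊎_; inj₁; inj₂)
open import Data.Sum.Properties using (inj₁-injective; inj₂-injective)
open import Function using (_∘_)
open import Function.Definitions using (Injective)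
open import Relation.Nullary using (¬_; Dec; yes; no; does; ¬?)
open import Relation.Nullary.Decidable using (decidable-stable)
open import Relation.Binary.PropositionalEquality
  using (_≡_; refl; sym; trans; cong; module ≡-Reasoning)
open import Algebra.Properties.CommutativeMonoid.Sum +-0-commutativeMonoid using (∑-comm)

private
  variable
    m n p q : ℕ

Σ-Fin-≥-term : (f : Fin n → ℕ) (t : Fin n) → f t ≤ Σ-Fin n f
Σ-Fin-≥-term f zero    = m≤m+n _ _
Σ-Fin-≥-term f (suc t) = ≤-trans (Σ-Fin-≥-term (f ∘ suc) t) (m≤n+m _ _)

-- Block s of Fin (Σ-Fin m c) has size c s; this is its first element.
blockStart : (c : Fin m → ℕ) (s : Fin m) → 0 < c s → Fin (Σ-Fin m c)
blockStart c zero    0<c = fromℕ< 0<c ↑ˡ _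
blockStart c (suc s) 0<c = c zero ↑ʳ blockStart (c ∘ suc) s 0<c

↑ˡ≢↑ʳ : ∀ m {n} (i : Fin m) (j : Fin n) → ¬ i ↑ˡ n ≡ m ↑ʳ j
↑ˡ≢↑ʳ m {n} i j e
  with () ← trans (sym (splitAt-↑ˡ m i n)) (trans (cong (splitAt m) e) (splitAt-↑ʳ m n j))

blockStart-injective : (c : Fin m → ℕ) (s s′ : Fin m) (h : 0 < c s) (h′ : 0 < c s′) →
  blockStart c s h ≡ blockStart c s′ h′ → s ≡ s′
blockStart-injective c zero    zero     _ _ _ = refl
blockStart-injective c zero    (suc _)  _ _ e with () ← ↑ˡ≢↑ʳ (c zero) _ _ e
blockStart-injective c (suc _) zero     _ _ e with () ← ↑ˡ≢↑ʳ (c zero) _ _ (sym e)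
blockStart-injective c (suc s) (suc s′) h h′ e =
  cong suc (blockStart-injective (c ∘ suc) s s′ h h′ (↑ʳ-injective (c zero) _ _ e))

join-injective : Injective _≡_ _≡_ (join m n)
join-injective {m} {n} {x} {y} e =
  trans (sym (splitAt-join m n x)) (trans (cong (splitAt m) e) (splitAt-join m n y))

_ᵀ : BinMatrix m n → BinMatrix n m
(A ᵀ) t s = A s t

isPMatrix-ᵀ : {P : BinMatrix p q} {B : BinMatrix m n} → IsPMatrix P B → IsPMatrix (P ᵀ) (B ᵀ)
isPMatrix-ᵀ (rowPart , colPart , B≡P) = colPart , rowPart , λ t s → B≡P s t

dist-ᵀ : (A B : BinMatrix m n) → dist (A ᵀ) (B ᵀ) ≡ dist A B
dist-ᵀ A B = sym (∑-comm (λ s t → if does (A s t ≟ B s t) then 0 else 1))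

atMostDistinctRows-mono : (A : BinMatrix m n) {c c′ : ℕ} →
  AtMostDistinctRows A c → c ≤ c′ → AtMostDistinctRows A c′
atMostDistinctRows-mono A bound c≤c′ r g distinct = ≤-trans (bound r g distinct) c≤c′

module _ (A B : BinMatrix m n) where

  rowDist : Fin m → ℕ
  rowDist s = Σ-Fin n (λ t → if does (A s t ≟ B s t) then 0 else 1)

  Changed : Fin m → Set
  Changed s = ∃ λ t → ¬ A s t ≡ B s t

  changed? : (s : Fin m) → Dec (Changed s)
  changed? s = any? (λ t → ¬? (A s t ≟ B s t))

  rowDist-positive : (s : Fin m) → Changed s → 0 < rowDist s
  rowDist-positive s (t , A≢B) = ≤-trans (mismatch-positive (A s t ≟ B s t)) (Σ-Fin-≥-term _ t)
    where
    mismatch-positive : (d : Dec (A s t ≡ B s t)) → 0 < (if does d then 0 else 1)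
    mismatch-positive (yes A≡B) with () ← A≢B A≡B
    mismatch-positive (no _)    = s≤s z≤n

  unchanged : (s : Fin m) → ¬ Changed s → ∀ t → A s t ≡ B s t
  unchanged s ¬changed t = decidable-stable (A s t ≟ B s t) (λ A≢B → ¬changed (t , A≢B))

  module _ (P : BinMatrix p q) (rowPart : Fin m → Fin p) (colPart : Fin n → Fin q)
           (B≡P : ∀ s t → B s t ≡ P (rowPart s) (colPart t)) where

    rowCode : (s : Fin m) → Dec (Changed s) → Fin p ⊎ Fin (dist A B)
    rowCode s (yes changed) = inj₂ (blockStart rowDist s (rowDist-positive s changed))
    rowCode s (no _)        = inj₁ (rowPart s)

    rowCode-≡⇒rows-≡ : (s s′ : Fin m) (d : Dec (Changed s)) (d′ : Dec (Changed s′)) →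
      rowCode s d ≡ rowCode s′ d′ → ∀ t → A s t ≡ A s′ t
    rowCode-≡⇒rows-≡ s s′ (yes _) (yes _) e t
      with refl ← blockStart-injective rowDist s s′ _ _ (inj₂-injective e) = refl
    rowCode-≡⇒rows-≡ s s′ (no ¬c) (no ¬c′) e t = begin
      A s t                      ≡⟨ unchanged s ¬c t ⟩
      B s t                      ≡⟨ B≡P s t ⟩
      P (rowPart s) (colPart t)  ≡⟨ cong (λ i → P i (colPart t)) (inj₁-injective e) ⟩
      P (rowPart s′) (colPart t) ≡⟨ sym (B≡P s′ t) ⟩
      B s′ t                     ≡⟨ sym (unchanged s′ ¬c′ t) ⟩
      A s′ t                     ∎
      where open ≡-Reasoning
    rowCode-≡⇒rows-≡ s s′ (yes _) (no _) () t
    rowCode-≡⇒rows-≡ s s′ (no _) (yes _) () t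

distinctRows≤ : (A B : BinMatrix m n) (P : BinMatrix p q) → IsPMatrix P B →
  AtMostDistinctRows A (p + dist A B)
distinctRows≤ {p = p} A B P (rowPart , colPart , B≡P) r g distinct =
  injective⇒≤ (code-injective ∘ join-injective)
  where
  code : Fin r → Fin p ⊎ Fin (dist A B)
  code i = rowCode A B P rowPart colPart B≡P (g i) (changed? A B (g i))

  code-injective : Injective _≡_ _≡_ code
  code-injective {i} {j} e = decidable-stable (i ≟ᶠ j) λ i≢j →
    let (t , rows-differ) = distinct i j i≢j
    in rows-differ (rowCode-≡⇒rows-≡ A B P rowPart colPart B≡P (g i) (g j) _ _ e t)

lemma8 : {m n p q : ℕ} (A : BinMatrix m n) (P : BinMatrix p q) (k : ℕ) →
    YesInstance A P k →
    AtMostDistinctRows A (p + k) × AtMostDistinctCols A (q + k)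
lemma8 {p = p} {q} A P k (B , isP , dist≤k) =
  atMostDistinctRows-mono A (distinctRows≤ A B P isP) (+-monoʳ-≤ p dist≤k) ,
  atMostDistinctRows-mono (A ᵀ) (distinctRows≤ (A ᵀ) (B ᵀ) (P ᵀ) (isPMatrix-ᵀ {P = P} {B = B} isP))
    (+-monoʳ-≤ q (≤-trans (≤-reflexive (dist-ᵀ A B)) dist≤k))
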